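{- Let $H$ be a Kekul\'ean hexagonal system and let $C,C'$ be Clar covers of $H$. Then $f(C)$ is a subgraph of $f(C')$ (i.e. $C\le C'$) if and only if every hexagon of $C$ is a hexagon of $C'$ and $C$ and $C'$ coincide on the edges apart from those in the hexagons of $C'$, i.e. $E(C)\setminus E_{C'}=E(C')\setminus E_{C'}$, where $E_{C'}$ denotes the set of edges lying in hexagons of $C'$.
   Context: A hexagonal system is a 2-connected finite plane graph in which every interior face is a regular hexagon of side length one; its hexagons are the boundaries of its interior faces. $H$ is Kekul\'ean if it has a perfect matching. A Clar cover of $H$ is a spanning subgraph of $H$ each of whose connected components is either a hexagon of $H$ or a single edge. The resonance graph $R(H)$ has the perfect matchings of $H$ as vertices, two perfect matchings $M,M'$ being adjacent iff $M\oplus M'$ is the edge set of a hexagon of $H$. A cycle is $M$-alternating if its edges alternately belong and do not belong to $M$. For a Clar cover $C$, $f(C)$ is the subgraph of $R(H)$ induced by all perfect matchings $M$ of $H$ such that every hexagon of $C$ is $M$-alternating and every single-edge component of $C$ belongs to $M$. -}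

module Defs where

open import Data.Integer using (ℤ; suc; pred)
open import Data.Product using (Σ; _×_; _,_)
open import Data.Sum using (_⊎_)
open import Data.List using (List; []; _∷_)
open import Data.List.Membership.Propositional using (_∈_; _∉_)
open import Data.Empty using (⊥)
open import Relation.Binary.PropositionalEquality using (_≡_; _≢_)
open import Relation.Nullary using (¬_)
open import Function.Bundles using (_⇔_)

-- The hexagonal (honeycomb) lattice, as a plane graph, in "brick" coordinates.
-- Vertices: (i , j , A) and (i , j , B), i j ∈ ℤ (the two colour classes).
-- Each lattice edge is represented uniquely by its A-endpoint and a direction.

data Side : Set where
  A B : Side

Vertex : Set
Vertex = ℤ × ℤ × Side

data Dir : Set where
  d0 d1 d2 : Dir

Edge : Set
Edge = ℤ × ℤ × Dir

endA : Edge → Vertex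
endA (i , j , _) = (i , j , A)

endB : Edge → Vertex
endB (i , j , d0) = (i , j , B)
endB (i , j , d1) = (pred i , j , B)
endB (i , j , d2) = (i , pred j , B)

Inc : Vertex → Edge → Set
Inc v e = (v ≡ endA e) ⊎ (v ≡ endB e)

Joins : Edge → Vertex → Vertex → Set
Joins e u w = (u ≡ endA e × w ≡ endB e) ⊎ (u ≡ endB e × w ≡ endA e)

-- Hexagonal cells (faces of the lattice, unit regular hexagons), indexed by ℤ²
Cell : Set
Cell = ℤ × ℤ

-- the six edges of cell (i,j), listed in cyclic order around the hexagon
-- A(i,j) B(i,j) A(i+1,j) B(i+1,j-1) A(i+1,j-1) B(i,j-1) A(i,j)
hexEdges : Cell → List Edge
hexEdges (i , j) =
  (i , j , d0) ∷ (suc i , j , d1) ∷ (suc i , j , d2) ∷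
  (suc i , pred j , d0) ∷ (suc i , pred j , d1) ∷ (i , j , d2) ∷ []

CellAdj : Cell → Cell → Set
CellAdj c d = c ≢ d × Σ Edge (λ e → e ∈ hexEdges c × e ∈ hexEdges d)

data CellPath (S : List Cell) : Cell → Cell → Set where
  stop : ∀ {c} → c ∉ S → CellPath S c c
  step : ∀ {c d c'} → c ∉ S → CellAdj c d → CellPath S d c' → CellPath S c c'

data Reach (E : Edge → Set) (ok : Vertex → Set) : Vertex → Vertex → Set where
  here : ∀ {u} → ok u → Reach E ok u u
  step : ∀ {u w v} (e : Edge) → ok u → E e → Joins e u w → Reach E ok w v → Reach E ok u v

InEdges : List Cell → Edge → Set
InEdges S e = Σ Cell (λ c → c ∈ S × e ∈ hexEdges c)

InVerts : List Cell → Vertex → Set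
InVerts S v = Σ Edge (λ e → InEdges S e × Inc v e)

-- 2-connected: (at least 3 vertices, ensured by nonemptiness: a cell has 6)
-- and deleting any single vertex leaves the graph connected
TwoConnected : List Cell → Set
TwoConnected S = Σ Cell (λ c → c ∈ S) ×
  (∀ x u v → InVerts S u → InVerts S v → u ≢ x → v ≢ x →
     Reach (InEdges S) (λ w → w ≢ x) u v)

-- A hexagonal system: a finite plane subgraph H of the honeycomb lattice that is the
-- union of the boundaries of its hexagons `cells`, H is 2-connected, and every
-- interior face of H is one of these hexagons; the latter says exactly that all
-- lattice cells not in `cells` lie in a single face (necessarily the outer one),
-- i.e. the complement of `cells` is connected via shared edges (such edges are not
-- in H).
record HexSystem : Set where
  field
    cells : List Cell
    twoConnected : TwoConnected cells
    outerFace : ∀ c c' → c ∉ cells → c' ∉ cells → CellPath cells c c'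
open HexSystem public

E : HexSystem → Edge → Set
E H = InEdges (cells H)

V : HexSystem → Vertex → Set
V H = InVerts (cells H)

PerfectMatching : HexSystem → List Edge → Set
PerfectMatching H M =
  (∀ e → e ∈ M → E H e) ×
  (∀ v → V H v → Σ Edge (λ e → e ∈ M × Inc v e)) ×
  (∀ v e e' → e ∈ M → e' ∈ M → Inc v e → Inc v e' → e ≡ e')

Kekulean : HexSystem → Set
Kekulean H = Σ (List Edge) (PerfectMatching H)

AltCycle : List Edge → List Edge → Set
AltCycle M (a ∷ b ∷ c ∷ d ∷ e ∷ f ∷ []) =
  (a ∈ M × b ∉ M × c ∈ M × d ∉ M × e ∈ M × f ∉ M) ⊎
  (a ∉ M × b ∈ M × c ∉ M × d ∈ M × e ∉ M × f ∈ M)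
AltCycle M _ = ⊥

Alternating : List Edge → Cell → Set
Alternating M c = AltCycle M (hexEdges c)

record Graph : Set₁ where
  field
    Vtx : List Edge → Set
    Adj : List Edge → List Edge → Set
open Graph public

SymDiff : List Edge → List Edge → Edge → Set
SymDiff M M' e = (e ∈ M × e ∉ M') ⊎ (e ∈ M' × e ∉ M)

R : HexSystem → Graph
Vtx (R H) M = PerfectMatching H M
Adj (R H) M M' = PerfectMatching H M × PerfectMatching H M' ×
  Σ Cell (λ h → h ∈ cells H × (∀ e → SymDiff M M' e ⇔ (e ∈ hexEdges h)))

Induced : Graph → (List Edge → Set) → Graph
Vtx (Induced G P) M = Vtx G M × P M
Adj (Induced G P) M M' = Adj G M M' × P M × P M'

Subgraph : Graph → Graph → Set
Subgraph G G' = (∀ M → Vtx G M → Vtx G' M) × (∀ M M' → Adj G M M' → Adj G' M M')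

-- Clar covers, given by the list of their connected components

data Comp : Set where
  hex : Cell → Comp
  edge : Edge → Comp

compEdges : Comp → List Edge
compEdges (hex c) = hexEdges c
compEdges (edge e) = e ∷ []

InComp : Vertex → Comp → Set
InComp v k = Σ Edge (λ e → e ∈ compEdges k × Inc v e)

CompOf : HexSystem → Comp → Set
CompOf H (hex c) = c ∈ cells H
CompOf H (edge e) = E H e

ClarCover : HexSystem → List Comp → Set
ClarCover H C =
  (∀ k → k ∈ C → CompOf H k) ×
  (∀ v → V H v → Σ Comp (λ k → k ∈ C × InComp v k)) ×
  (∀ v k k' → k ∈ C → k' ∈ C → InComp v k → InComp v k' → k ≡ k')

EdgeOf : List Comp → Edge → Set
EdgeOf C e = Σ Comp (λ k → k ∈ C × e ∈ compEdges k)

HexEdgeOf : List Comp → Edge → Set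
HexEdgeOf C e = Σ Cell (λ h → hex h ∈ C × e ∈ hexEdges h)

InF : List Comp → List Edge → Set
InF C M = (∀ h → hex h ∈ C → Alternating M h) × (∀ e → edge e ∈ C → e ∈ M)

f : HexSystem → List Comp → Graph
f H C = Induced (R H) (InF C)

-- Each hexagon of a Clar cover C has exactly two perfect matchings, so choosing one of them
-- for every hexagon and keeping the single edges gives perfect matchings of H in f(C); taking
-- the same choice everywhere yields two of them that differ on every hexagon of C. If
-- f(C) ⊆ f(C'), the component of C' at a corner of a hexagon h of C must contain both
-- edges of h at that corner, hence is h itself; and since every edge of a perfect matching in
-- f(D) is an edge of D, the single edges of C and C' outside the hexagons of C' agree.
-- Conversely, under the two conditions the edge of a matching in f(C) at a corner of a hexagon
-- h of C' lies in h, so the matching alternates on h; it also contains the single edges of C'.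
module Submission where

open import Data.Bool using (Bool; true; false; not)
open import Data.Bool.Properties using (¬-not) renaming (_≟_ to _≟𝔹_)
open import Data.Empty using (⊥; ⊥-elim)
open import Data.Integer using (ℤ; suc; pred)
open import Data.Integer.Properties using (i≢suc[i]; suc-pred; pred-suc) renaming (_≟_ to _≟ℤ_)
open import Data.List using (List; []; _∷_; concatMap)
open import Data.List.Membership.Propositional using (_∈_; find; lose)
open import Data.List.Membership.Propositional.Properties using (∈-concatMap⁺; ∈-concatMap⁻)
open import Data.List.Relation.Unary.Any using (here; there)
open import Data.Product using (Σ; _×_; _,_; proj₁; proj₂)
open import Data.Product.Properties using (≡-dec)
open import Data.Sum using (_⊎_; inj₁; inj₂) renaming (map to map-⊎)
open import Function.Bundles using (_⇔_; mk⇔; Equivalence)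
open import Relation.Binary.Definitions using (DecidableEquality)
open import Relation.Binary.PropositionalEquality using (_≡_; _≢_; refl; sym; trans; cong; subst; ≢-sym)
open import Relation.Nullary using (¬_; yes; no)
open import Relation.Nullary.Decidable using (decidable-stable)

open import Defs

i≢pred[i] : ∀ {i} → i ≢ pred i
i≢pred[i] {i} i≡pred[i] = i≢suc[i] (trans (sym i≡pred[i]) (sym (suc-pred i)))

coord₂ : ∀ {X : Set} → ℤ × ℤ × X → ℤ
coord₂ (_ , j , _) = j

pred-suc-vertex : ∀ {i j : ℤ} {s : Side} → (pred (suc i) , j , s) ≡ (i , j , s)
pred-suc-vertex {i} {j} {s} = cong (λ x → (x , j , s)) (pred-suc i)

_≟ᴰ_ : DecidableEquality Dir
d0 ≟ᴰ d0 = yes refl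
d1 ≟ᴰ d1 = yes refl
d2 ≟ᴰ d2 = yes refl
d0 ≟ᴰ d1 = no λ ()
d0 ≟ᴰ d2 = no λ ()
d1 ≟ᴰ d0 = no λ ()
d1 ≟ᴰ d2 = no λ ()
d2 ≟ᴰ d0 = no λ ()
d2 ≟ᴰ d1 = no λ ()

_≟ᴱ_ : DecidableEquality Edge
_≟ᴱ_ = ≡-dec _≟ℤ_ (≡-dec _≟ℤ_ _≟ᴰ_)

open import Data.List.Membership.DecPropositional _≟ᴱ_ using (_∈?_)

joins-incˡ : ∀ {e u w} → Joins e u w → Inc u e
joins-incˡ (inj₁ (u≡ , _)) = inj₁ u≡
joins-incˡ (inj₂ (u≡ , _)) = inj₂ u≡

joins-incʳ : ∀ {e u w} → Joins e u w → Inc w e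
joins-incʳ (inj₁ (_ , w≡)) = inj₂ w≡
joins-incʳ (inj₂ (_ , w≡)) = inj₁ w≡

inc-joins : ∀ {e u w v} → Joins e u w → Inc v e → v ≡ u ⊎ v ≡ w
inc-joins (inj₁ (refl , refl)) (inj₁ v≡) = inj₁ v≡
inc-joins (inj₁ (refl , refl)) (inj₂ v≡) = inj₂ v≡
inc-joins (inj₂ (refl , refl)) (inj₁ v≡) = inj₂ v≡
inc-joins (inj₂ (refl , refl)) (inj₂ v≡) = inj₁ v≡

data Corner : Set where
  c₀ c₁ c₂ c₃ c₄ c₅ : Corner

next : Corner → Corner
next c₀ = c₁
next c₁ = c₂
next c₂ = c₃
next c₃ = c₄
next c₄ = c₅
next c₅ = c₀

prev : Corner → Corner
prev c₀ = c₅
prev c₁ = c₀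
prev c₂ = c₁
prev c₃ = c₂
prev c₄ = c₃
prev c₅ = c₄

prev-next : ∀ k → prev (next k) ≡ k
prev-next c₀ = refl
prev-next c₁ = refl
prev-next c₂ = refl
prev-next c₃ = refl
prev-next c₄ = refl
prev-next c₅ = refl

next-prev : ∀ k → next (prev k) ≡ k
next-prev c₀ = refl
next-prev c₁ = refl
next-prev c₂ = refl
next-prev c₃ = refl
next-prev c₄ = refl
next-prev c₅ = refl

next-injective : ∀ {k k'} → next k ≡ next k' → k ≡ k'
next-injective {k} {k'} eq = trans (sym (prev-next k)) (trans (cong prev eq) (prev-next k'))

parity : Corner → Bool
parity c₀ = true
parity c₁ = false
parity c₂ = true
parity c₃ = false
parity c₄ = true
parity c₅ = false

parity-next≢ : ∀ k → parity (next k) ≢ parity k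
parity-next≢ c₀ ()
parity-next≢ c₁ ()
parity-next≢ c₂ ()
parity-next≢ c₃ ()
parity-next≢ c₄ ()
parity-next≢ c₅ ()

parity-prev : ∀ k → parity (prev k) ≡ not (parity k)
parity-prev c₀ = refl
parity-prev c₁ = refl
parity-prev c₂ = refl
parity-prev c₃ = refl
parity-prev c₄ = refl
parity-prev c₅ = refl

-- side h k joins corner h k to corner h (next k); hexEdges h is side h c₀ ∷ … ∷ side h c₅.
corner : Cell → Corner → Vertex
corner (i , j) c₀ = (i , j , A)
corner (i , j) c₁ = (i , j , B)
corner (i , j) c₂ = (suc i , j , A)
corner (i , j) c₃ = (suc i , pred j , B)
corner (i , j) c₄ = (suc i , pred j , A)
corner (i , j) c₅ = (i , pred j , B)

side : Cell → Corner → Edge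
side (i , j) c₀ = (i , j , d0)
side (i , j) c₁ = (suc i , j , d1)
side (i , j) c₂ = (suc i , j , d2)
side (i , j) c₃ = (suc i , pred j , d0)
side (i , j) c₄ = (suc i , pred j , d1)
side (i , j) c₅ = (i , j , d2)

side-joins : ∀ h k → Joins (side h k) (corner h k) (corner h (next k))
side-joins (i , j) c₀ = inj₁ (refl , refl)
side-joins (i , j) c₁ = inj₂ (sym pred-suc-vertex , refl)
side-joins (i , j) c₂ = inj₁ (refl , refl)
side-joins (i , j) c₃ = inj₂ (refl , refl)
side-joins (i , j) c₄ = inj₁ (refl , sym pred-suc-vertex)
side-joins (i , j) c₅ = inj₂ (refl , refl)

side∈hexEdges : ∀ h k → side h k ∈ hexEdges h
side∈hexEdges (i , j) c₀ = here refl
side∈hexEdges (i , j) c₁ = there (here refl)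
side∈hexEdges (i , j) c₂ = there (there (here refl))
side∈hexEdges (i , j) c₃ = there (there (there (here refl)))
side∈hexEdges (i , j) c₄ = there (there (there (there (here refl))))
side∈hexEdges (i , j) c₅ = there (there (there (there (there (here refl)))))

∈hexEdges⇒side : ∀ h {x} → x ∈ hexEdges h → Σ Corner (λ k → x ≡ side h k)
∈hexEdges⇒side (i , j) (here refl) = c₀ , refl
∈hexEdges⇒side (i , j) (there (here refl)) = c₁ , refl
∈hexEdges⇒side (i , j) (there (there (here refl))) = c₂ , refl
∈hexEdges⇒side (i , j) (there (there (there (here refl)))) = c₃ , refl
∈hexEdges⇒side (i , j) (there (there (there (there (here refl))))) = c₄ , refl
∈hexEdges⇒side (i , j) (there (there (there (there (there (here refl)))))) = c₅ , refl

side≢side-prev : ∀ h k → side h k ≢ side h (prev k)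
side≢side-prev (i , j) c₀ ()
side≢side-prev (i , j) c₁ ()
side≢side-prev (i , j) c₂ ()
side≢side-prev (i , j) c₃ ()
side≢side-prev (i , j) c₄ ()
side≢side-prev (i , j) c₅ ()

corner-injective : ∀ h {k k'} → corner h k ≡ corner h k' → k ≡ k'
corner-injective (i , j) {c₀} {c₀} _ = refl
corner-injective (i , j) {c₁} {c₁} _ = refl
corner-injective (i , j) {c₂} {c₂} _ = refl
corner-injective (i , j) {c₃} {c₃} _ = refl
corner-injective (i , j) {c₄} {c₄} _ = refl
corner-injective (i , j) {c₅} {c₅} _ = refl
corner-injective (i , j) {c₀} {c₂} eq = ⊥-elim (i≢suc[i] (cong proj₁ eq))
corner-injective (i , j) {c₀} {c₄} eq = ⊥-elim (i≢suc[i] (cong proj₁ eq))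
corner-injective (i , j) {c₂} {c₀} eq = ⊥-elim (i≢suc[i] (sym (cong proj₁ eq)))
corner-injective (i , j) {c₂} {c₄} eq = ⊥-elim (i≢pred[i] (cong coord₂ eq))
corner-injective (i , j) {c₄} {c₀} eq = ⊥-elim (i≢suc[i] (sym (cong proj₁ eq)))
corner-injective (i , j) {c₄} {c₂} eq = ⊥-elim (i≢pred[i] (sym (cong coord₂ eq)))
corner-injective (i , j) {c₁} {c₃} eq = ⊥-elim (i≢suc[i] (cong proj₁ eq))
corner-injective (i , j) {c₁} {c₅} eq = ⊥-elim (i≢pred[i] (cong coord₂ eq))
corner-injective (i , j) {c₃} {c₁} eq = ⊥-elim (i≢suc[i] (sym (cong proj₁ eq)))
corner-injective (i , j) {c₃} {c₅} eq = ⊥-elim (i≢suc[i] (sym (cong proj₁ eq)))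
corner-injective (i , j) {c₅} {c₁} eq = ⊥-elim (i≢pred[i] (sym (cong coord₂ eq)))
corner-injective (i , j) {c₅} {c₃} eq = ⊥-elim (i≢suc[i] (cong proj₁ eq))
corner-injective (i , j) {c₀} {c₁} ()
corner-injective (i , j) {c₀} {c₃} ()
corner-injective (i , j) {c₀} {c₅} ()
corner-injective (i , j) {c₂} {c₁} ()
corner-injective (i , j) {c₂} {c₃} ()
corner-injective (i , j) {c₂} {c₅} ()
corner-injective (i , j) {c₄} {c₁} ()
corner-injective (i , j) {c₄} {c₃} ()
corner-injective (i , j) {c₄} {c₅} ()
corner-injective (i , j) {c₁} {c₀} ()
corner-injective (i , j) {c₁} {c₂} ()
corner-injective (i , j) {c₁} {c₄} ()
corner-injective (i , j) {c₃} {c₀} ()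
corner-injective (i , j) {c₃} {c₂} ()
corner-injective (i , j) {c₃} {c₄} ()
corner-injective (i , j) {c₅} {c₀} ()
corner-injective (i , j) {c₅} {c₂} ()
corner-injective (i , j) {c₅} {c₄} ()

corner-inc-side : ∀ h k → Inc (corner h k) (side h k)
corner-inc-side h k = joins-incˡ (side-joins h k)

corner-inc-side-prev : ∀ h k → Inc (corner h k) (side h (prev k))
corner-inc-side-prev h k =
  subst (λ c → Inc (corner h c) (side h (prev k))) (next-prev k) (joins-incʳ (side-joins h (prev k)))

inc-side⇒corner : ∀ h k {v} → Inc v (side h k) → v ≡ corner h k ⊎ v ≡ corner h (next k)
inc-side⇒corner h k = inc-joins (side-joins h k)

inc-hexEdge⇒corner : ∀ h {x v} → x ∈ hexEdges h → Inc v x → Σ Corner (λ k → v ≡ corner h k)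
inc-hexEdge⇒corner h x∈h v∈x with ∈hexEdges⇒side h x∈h
... | l , refl with inc-side⇒corner h l v∈x
...   | inj₁ v≡ = l , v≡
...   | inj₂ v≡ = next l , v≡

hexEdge-at-corner : ∀ h k {x} → x ∈ hexEdges h → Inc (corner h k) x → x ≡ side h k ⊎ x ≡ side h (prev k)
hexEdge-at-corner h k x∈h k∈x with ∈hexEdges⇒side h x∈h
... | l , refl with inc-side⇒corner h l k∈x
...   | inj₁ k≡l = inj₁ (cong (side h) (sym (corner-injective h k≡l)))
...   | inj₂ k≡next-l =
  inj₂ (cong (side h) (trans (sym (prev-next l)) (cong prev (sym (corner-injective h k≡next-l)))))

hexagon-by-sides-at-c₀ : ∀ h h' → side h c₀ ∈ hexEdges h' → side h c₅ ∈ hexEdges h' → h' ≡ h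
hexagon-by-sides-at-c₀ (i , j) (i' , j') _ (there (there (there (there (there (here refl)))))) = refl
hexagon-by-sides-at-c₀ (.(suc i') , j) (i' , .j) (here eq) (there (there (here refl))) =
  ⊥-elim (i≢suc[i] (sym (cong proj₁ eq)))
hexagon-by-sides-at-c₀ (.(suc i') , j) (i' , .j) (there (there (there (here eq)))) (there (there (here refl))) =
  ⊥-elim (i≢pred[i] (cong coord₂ eq))
hexagon-by-sides-at-c₀ (i , j) (i' , j') (there (here ())) (there (there (here _)))
hexagon-by-sides-at-c₀ (i , j) (i' , j') (there (there (here ()))) (there (there (here _)))
hexagon-by-sides-at-c₀ (i , j) (i' , j') (there (there (there (there (here ()))))) (there (there (here _)))
hexagon-by-sides-at-c₀ (i , j) (i' , j') (there (there (there (there (there (here ())))))) (there (there (here _)))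
hexagon-by-sides-at-c₀ (i , j) (i' , j') _ (here ())
hexagon-by-sides-at-c₀ (i , j) (i' , j') _ (there (here ()))
hexagon-by-sides-at-c₀ (i , j) (i' , j') _ (there (there (there (here ()))))
hexagon-by-sides-at-c₀ (i , j) (i' , j') _ (there (there (there (there (here ())))))

alternating-of-corners : ∀ {M} h →
  (∀ k → side h k ∈ M ⊎ side h (prev k) ∈ M) →
  (∀ k → side h k ∈ M → side h (prev k) ∈ M → ⊥) →
  Alternating M h
alternating-of-corners (i , j) covered ¬both with covered c₀
... | inj₁ a with covered c₂ | covered c₄
...   | inj₂ b | _ = ⊥-elim (¬both c₁ b a)
...   | inj₁ c | inj₂ d = ⊥-elim (¬both c₃ d c)
...   | inj₁ c | inj₁ e = inj₁ (a , (λ b → ¬both c₁ b a) , c , (λ d → ¬both c₃ d c) , e , (λ f → ¬both c₅ f e))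
alternating-of-corners (i , j) covered ¬both | inj₂ f with covered c₁ | covered c₃
...   | inj₂ a | _ = ⊥-elim (¬both c₀ a f)
...   | inj₁ b | inj₂ c = ⊥-elim (¬both c₂ c b)
...   | inj₁ b | inj₁ d = inj₂ ((λ a → ¬both c₀ a f) , b , (λ c → ¬both c₂ c b) , d , (λ e → ¬both c₄ e d) , f)

alternating⇒corners : ∀ {M} h → Alternating M h → ∀ k → side h k ∈ M ⊎ side h (prev k) ∈ M
alternating⇒corners (i , j) (inj₁ (a , _ , c , _ , e , _)) c₀ = inj₁ a
alternating⇒corners (i , j) (inj₁ (a , _ , c , _ , e , _)) c₁ = inj₂ a
alternating⇒corners (i , j) (inj₁ (a , _ , c , _ , e , _)) c₂ = inj₁ c
alternating⇒corners (i , j) (inj₁ (a , _ , c , _ , e , _)) c₃ = inj₂ c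
alternating⇒corners (i , j) (inj₁ (a , _ , c , _ , e , _)) c₄ = inj₁ e
alternating⇒corners (i , j) (inj₁ (a , _ , c , _ , e , _)) c₅ = inj₂ e
alternating⇒corners (i , j) (inj₂ (_ , b , _ , d , _ , f)) c₀ = inj₂ f
alternating⇒corners (i , j) (inj₂ (_ , b , _ , d , _ , f)) c₁ = inj₁ b
alternating⇒corners (i , j) (inj₂ (_ , b , _ , d , _ , f)) c₂ = inj₂ b
alternating⇒corners (i , j) (inj₂ (_ , b , _ , d , _ , f)) c₃ = inj₁ d
alternating⇒corners (i , j) (inj₂ (_ , b , _ , d , _ , f)) c₄ = inj₂ d
alternating⇒corners (i , j) (inj₂ (_ , b , _ , d , _ , f)) c₅ = inj₁ f

kekule : Bool → Cell → List Edge
kekule true h = side h c₀ ∷ side h c₂ ∷ side h c₄ ∷ []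
kekule false h = side h c₁ ∷ side h c₃ ∷ side h c₅ ∷ []

side∈kekule : ∀ h k → side h k ∈ kekule (parity k) h
side∈kekule h c₀ = here refl
side∈kekule h c₁ = here refl
side∈kekule h c₂ = there (here refl)
side∈kekule h c₃ = there (here refl)
side∈kekule h c₄ = there (there (here refl))
side∈kekule h c₅ = there (there (here refl))

∈kekule⇒side : ∀ p h {x} → x ∈ kekule p h → Σ Corner (λ k → x ≡ side h k × parity k ≡ p)
∈kekule⇒side true h (here refl) = c₀ , refl , refl
∈kekule⇒side true h (there (here refl)) = c₂ , refl , refl
∈kekule⇒side true h (there (there (here refl))) = c₄ , refl , refl
∈kekule⇒side false h (here refl) = c₁ , refl , refl
∈kekule⇒side false h (there (here refl)) = c₃ , refl , refl
∈kekule⇒side false h (there (there (here refl))) = c₅ , refl , refl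

kekule-covers-corner : ∀ p h k → side h k ∈ kekule p h ⊎ side h (prev k) ∈ kekule p h
kekule-covers-corner p h k with parity k ≟𝔹 p
... | yes refl = inj₁ (side∈kekule h k)
... | no pk≢p =
  inj₂ (subst (λ b → side h (prev k) ∈ kekule b h)
              (trans (parity-prev k) (sym (¬-not (≢-sym pk≢p))))
              (side∈kekule h (prev k)))

kekule-unique-at : ∀ p h {v x x'} → x ∈ kekule p h → x' ∈ kekule p h → Inc v x → Inc v x' → x ≡ x'
kekule-unique-at p h x∈ x'∈ v∈x v∈x' with ∈kekule⇒side p h x∈ | ∈kekule⇒side p h x'∈
... | l , refl , pl | l' , refl , pl' with inc-side⇒corner h l v∈x | inc-side⇒corner h l' v∈x'
...   | inj₁ a | inj₁ b = cong (side h) (corner-injective h (trans (sym a) b))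
...   | inj₂ a | inj₂ b = cong (side h) (next-injective (corner-injective h (trans (sym a) b)))
...   | inj₁ a | inj₂ b with corner-injective h (trans (sym a) b)
...     | refl = ⊥-elim (parity-next≢ l' (trans pl (sym pl')))
kekule-unique-at p h x∈ x'∈ v∈x v∈x' | l , refl , pl | l' , refl , pl' | inj₂ a | inj₁ b
  with corner-injective h (trans (sym a) b)
... | refl = ⊥-elim (parity-next≢ l (trans pl' (sym pl)))

matching-avoids-adjacent-sides : ∀ H {M} → PerfectMatching H M →
  ∀ h k → side h k ∈ M → side h (prev k) ∈ M → ⊥
matching-avoids-adjacent-sides _ (_ , _ , unique) h k s∈M s'∈M =
  side≢side-prev h k (unique (corner h k) _ _ s∈M s'∈M (corner-inc-side h k) (corner-inc-side-prev h k))

alternating-of-perfect : ∀ H {M} h → PerfectMatching H M →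
  (∀ k → side h k ∈ M ⊎ side h (prev k) ∈ M) → Alternating M h
alternating-of-perfect H h pm covered = alternating-of-corners h covered (matching-avoids-adjacent-sides H pm h)

comp-edge∈E : ∀ {H C k x} → ClarCover H C → k ∈ C → x ∈ compEdges k → E H x
comp-edge∈E {k = hex h} (inH , _) k∈C x∈k = h , inH (hex h) k∈C , x∈k
comp-edge∈E {k = edge e} (inH , _) k∈C (here refl) = inH (edge e) k∈C

edge-comp-not-hex : ∀ {H C e} → ClarCover H C → edge e ∈ C → ¬ HexEdgeOf C e
edge-comp-not-hex {e = e} (_ , _ , disjoint) e∈C (g , g∈C , e∈g)
  with disjoint (endA e) (edge e) (hex g) e∈C g∈C (e , here refl , inj₁ refl) (e , e∈g , inj₁ refl)
... | ()

non-hex-edge-is-comp : ∀ {C e} → EdgeOf C e → ¬ HexEdgeOf C e → edge e ∈ C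
non-hex-edge-is-comp (hex h , h∈C , e∈h) ¬hex = ⊥-elim (¬hex (h , h∈C , e∈h))
non-hex-edge-is-comp (edge e , e∈C , here refl) _ = e∈C

matched-edge-in-comp : ∀ {C M v k} → InF C M → k ∈ C → InComp v k →
  Σ Edge (λ x → x ∈ compEdges k × x ∈ M × Inc v x)
matched-edge-in-comp {k = hex h} (alt , _) h∈C (y , y∈h , v∈y) with inc-hexEdge⇒corner h y∈h v∈y
... | k , refl with alternating⇒corners h (alt h h∈C) k
...   | inj₁ s∈M = side h k , side∈hexEdges h k , s∈M , corner-inc-side h k
...   | inj₂ s∈M = side h (prev k) , side∈hexEdges h (prev k) , s∈M , corner-inc-side-prev h k
matched-edge-in-comp {k = edge e} (_ , single) e∈C (y , here refl , v∈y) = e , here refl , single e e∈C , v∈y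

-- The component of C at an endpoint of x must cover that endpoint by an edge of M, which is x.
matching-edge∈EdgeOf : ∀ {H C M x} → ClarCover H C → PerfectMatching H M → InF C M → x ∈ M → EdgeOf C x
matching-edge∈EdgeOf {x = x} (_ , covers , _) (inH , _ , unique) inF x∈M
  with covers (endA x) (x , inH x x∈M , inj₁ refl)
... | k , k∈C , endA∈k with matched-edge-in-comp inF k∈C endA∈k
...   | y , y∈k , y∈M , endA∈y = k , k∈C , subst (_∈ compEdges k) (unique (endA x) y x y∈M x∈M endA∈y (inj₁ refl)) y∈k

choice : Bool → Comp → List Edge
choice p (hex h) = kekule p h
choice p (edge e) = e ∷ []

choice⊆compEdges : ∀ p k {x} → x ∈ choice p k → x ∈ compEdges k
choice⊆compEdges p (hex h) x∈ with ∈kekule⇒side p h x∈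
... | l , refl , _ = side∈hexEdges h l
choice⊆compEdges p (edge e) x∈ = x∈

choice-covers : ∀ p k {v} → InComp v k → Σ Edge (λ x → x ∈ choice p k × Inc v x)
choice-covers p (hex h) (y , y∈h , v∈y) with inc-hexEdge⇒corner h y∈h v∈y
... | k , refl with kekule-covers-corner p h k
...   | inj₁ s∈ = side h k , s∈ , corner-inc-side h k
...   | inj₂ s∈ = side h (prev k) , s∈ , corner-inc-side-prev h k
choice-covers p (edge e) (y , here refl , v∈y) = e , here refl , v∈y

choice-unique : ∀ p k {v x x'} → x ∈ choice p k → x' ∈ choice p k → Inc v x → Inc v x' → x ≡ x'
choice-unique p (hex h) = kekule-unique-at p h
choice-unique p (edge e) (here refl) (here refl) _ _ = refl

clarMatching : Bool → List Comp → List Edge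
clarMatching p = concatMap (choice p)

∈clarMatching⁻ : ∀ p C {x} → x ∈ clarMatching p C → Σ Comp (λ k → k ∈ C × x ∈ choice p k)
∈clarMatching⁻ p C x∈ = find (∈-concatMap⁻ (choice p) x∈)

∈clarMatching⁺ : ∀ p {C k x} → k ∈ C → x ∈ choice p k → x ∈ clarMatching p C
∈clarMatching⁺ p k∈C x∈ = ∈-concatMap⁺ (choice p) (lose k∈C x∈)

clarMatching-perfect : ∀ {H C} → ClarCover H C → ∀ p → PerfectMatching H (clarMatching p C)
clarMatching-perfect {H} {C} cc@(_ , covers , disjoint) p = ⊆E , covered , unique
  where
  ⊆E : ∀ x → x ∈ clarMatching p C → E H x
  ⊆E x x∈ with ∈clarMatching⁻ p C x∈
  ... | k , k∈C , x∈k = comp-edge∈E cc k∈C (choice⊆compEdges p k x∈k)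
  covered : ∀ v → V H v → Σ Edge (λ x → x ∈ clarMatching p C × Inc v x)
  covered v v∈H with covers v v∈H
  ... | k , k∈C , v∈k with choice-covers p k v∈k
  ...   | x , x∈k , v∈x = x , ∈clarMatching⁺ p k∈C x∈k , v∈x
  unique : ∀ v x x' → x ∈ clarMatching p C → x' ∈ clarMatching p C → Inc v x → Inc v x' → x ≡ x'
  unique v x x' x∈ x'∈ v∈x v∈x' with ∈clarMatching⁻ p C x∈ | ∈clarMatching⁻ p C x'∈
  ... | k , k∈C , x∈k | k' , k'∈C , x'∈k'
    with disjoint v k k' k∈C k'∈C (x , choice⊆compEdges p k x∈k , v∈x) (x' , choice⊆compEdges p k' x'∈k' , v∈x')
  ... | refl = choice-unique p k x∈k x'∈k' v∈x v∈x'

clarMatching∈f : ∀ {H C} → ClarCover H C → ∀ p → InF C (clarMatching p C)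
clarMatching∈f {H} {C} cc p = alternates , single
  where
  alternates : ∀ h → hex h ∈ C → Alternating (clarMatching p C) h
  alternates h h∈C = alternating-of-perfect H h (clarMatching-perfect cc p) λ k →
    map-⊎ (∈clarMatching⁺ p h∈C) (∈clarMatching⁺ p h∈C) (kekule-covers-corner p h k)
  single : ∀ e → edge e ∈ C → e ∈ clarMatching p C
  single e e∈C = ∈clarMatching⁺ p e∈C (here refl)

resonance-induced-mono : ∀ H {P Q : List Edge → Set} →
  (∀ {M} → PerfectMatching H M → P M → Q M) → Subgraph (Induced (R H) P) (Induced (R H) Q)
resonance-induced-mono H P⇒Q =
  (λ { M (pm , p) → pm , P⇒Q pm p }) ,
  (λ { M M' (adj@(pm , pm' , _) , p , p') → adj , P⇒Q pm p , P⇒Q pm' p' })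

comp-with-sides-at-c₀ : ∀ h k → side h c₀ ∈ compEdges k → side h c₅ ∈ compEdges k → k ≡ hex h
comp-with-sides-at-c₀ h (hex h') s₀∈ s₅∈ = cong hex (hexagon-by-sides-at-c₀ h h' s₀∈ s₅∈)
comp-with-sides-at-c₀ h (edge e) (here s₀≡e) (here s₅≡e) = ⊥-elim (side≢side-prev h c₀ (trans s₀≡e (sym s₅≡e)))

module Forward {H C C'} (cc : ClarCover H C) (cc' : ClarCover H C') (sub : Subgraph (f H C) (f H C')) where

  matching∈f' : ∀ p → InF C' (clarMatching p C)
  matching∈f' p = proj₂ (proj₁ sub (clarMatching p C) (clarMatching-perfect cc p , clarMatching∈f cc p))

  matching⊆EdgeOf' : ∀ p {x} → x ∈ clarMatching p C → EdgeOf C' x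
  matching⊆EdgeOf' p = matching-edge∈EdgeOf cc' (clarMatching-perfect cc p) (matching∈f' p)

  -- The two uniform choices put both sides of h at c₀ into matchings in f(C'), and those
  -- sides share the corner c₀, so they lie in one component of C'.
  hexagons-kept : ∀ h → hex h ∈ C → hex h ∈ C'
  hexagons-kept h h∈C
    with matching⊆EdgeOf' true (∈clarMatching⁺ true h∈C (side∈kekule h c₀))
       | matching⊆EdgeOf' false (∈clarMatching⁺ false h∈C (side∈kekule h c₅))
  ... | k , k∈C' , s₀∈k | k' , k'∈C' , s₅∈k'
    with proj₂ (proj₂ cc') (corner h c₀) k k' k∈C' k'∈C'
           (side h c₀ , s₀∈k , corner-inc-side h c₀) (side h c₅ , s₅∈k' , corner-inc-side-prev h c₀)
  ... | refl = subst (_∈ C') (comp-with-sides-at-c₀ h k s₀∈k s₅∈k') k∈C'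

  edges-kept : ∀ {e} → EdgeOf C e → ¬ HexEdgeOf C' e → EdgeOf C' e
  edges-kept (hex h , h∈C , e∈h) ¬hex = ⊥-elim (¬hex (h , hexagons-kept h h∈C , e∈h))
  edges-kept (edge e , e∈C , here refl) _ = matching⊆EdgeOf' true (∈clarMatching⁺ true e∈C (here refl))

  edges-returned : ∀ {e} → EdgeOf C' e → ¬ HexEdgeOf C' e → EdgeOf C e
  edges-returned {e} eC' ¬hex =
    matching-edge∈EdgeOf cc (clarMatching-perfect cc true) (clarMatching∈f cc true)
      (proj₂ (matching∈f' true) e (non-hex-edge-is-comp eC' ¬hex))

  same-edges : ∀ e → (EdgeOf C e × ¬ HexEdgeOf C' e) ⇔ (EdgeOf C' e × ¬ HexEdgeOf C' e)
  same-edges e = mk⇔ (λ { (eC , ¬hex) → edges-kept eC ¬hex , ¬hex })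
                     (λ { (eC' , ¬hex) → edges-returned eC' ¬hex , ¬hex })

module Backward {H C C'} (cc : ClarCover H C) (cc' : ClarCover H C')
  (hexagons-kept : ∀ h → hex h ∈ C → hex h ∈ C')
  (same-edges : ∀ e → (EdgeOf C e × ¬ HexEdgeOf C' e) ⇔ (EdgeOf C' e × ¬ HexEdgeOf C' e)) where

  open Equivalence

  InF-mono : ∀ {M} → PerfectMatching H M → InF C M → InF C' M
  InF-mono {M} pm@(_ , covers , _) inF = alternates , single
    where
    single : ∀ e → edge e ∈ C' → e ∈ M
    single e e∈C' with from (same-edges e) ((edge e , e∈C' , here refl) , edge-comp-not-hex cc' e∈C')
    ... | eC , ¬hex' =
      proj₂ inF e (non-hex-edge-is-comp eC λ { (g , g∈C , e∈g) → ¬hex' (g , hexagons-kept g g∈C , e∈g) })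

    alternates : ∀ h → hex h ∈ C' → Alternating M h
    alternates h h∈C' = alternating-of-perfect H h pm corner-matched
      where
      corner-matched : ∀ k → side h k ∈ M ⊎ side h (prev k) ∈ M
      corner-matched k
        with covers (corner h k) (side h k , (h , proj₁ cc' (hex h) h∈C' , side∈hexEdges h k) , corner-inc-side h k)
      ... | x , x∈M , k∈x with hexEdge-at-corner h k (decidable-stable (x ∈? hexEdges h) ¬¬x∈h) k∈x
        where
        in-h : ∀ {k'} → k' ∈ C' → x ∈ compEdges k' → x ∈ hexEdges h
        in-h {k'} k'∈C' x∈k' with proj₂ (proj₂ cc') (corner h k) k' (hex h) k'∈C' h∈C'
                                      (x , x∈k' , k∈x) (side h k , side∈hexEdges h k , corner-inc-side h k)
        ... | refl = x∈k'
        -- Whether or not x lies in a hexagon of C', it is an edge of C' at a corner of h.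
        ¬¬x∈h : ¬ ¬ x ∈ hexEdges h
        ¬¬x∈h x∉h with to (same-edges x) (matching-edge∈EdgeOf cc pm inF x∈M ,
                                             λ { (g , g∈C' , x∈g) → x∉h (in-h g∈C' x∈g) })
        ... | (k' , k'∈C' , x∈k') , _ = x∉h (in-h k'∈C' x∈k')
      ... | inj₁ refl = inj₁ x∈M
      ... | inj₂ refl = inj₂ x∈M

  subgraph : Subgraph (f H C) (f H C')
  subgraph = resonance-induced-mono H InF-mono

theorem3 : (H : HexSystem) → Kekulean H → (C C' : List Comp) →
    ClarCover H C → ClarCover H C' →
    Subgraph (f H C) (f H C') ⇔
      ((∀ h → hex h ∈ C → hex h ∈ C') ×
       (∀ e → (EdgeOf C e × ¬ HexEdgeOf C' e) ⇔ (EdgeOf C' e × ¬ HexEdgeOf C' e)))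
theorem3 H _ C C' cc cc' = mk⇔
  (λ sub → let open Forward cc cc' sub in hexagons-kept , same-edges)
  (λ { (hexagons-kept , same-edges) → Backward.subgraph cc cc' hexagons-kept same-edges })
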